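{- A proper set system $S$ is a delta-matroid if and only if $S$ has no minor isomorphic to a set system in $\mathcal{S}\cup\mathcal{T}$.
   Context: A set system is a pair $S=(E,\mathcal{F})$ with $E$ a finite set and $\mathcal{F}$ a collection of subsets of $E$ (feasible sets); it is proper if $\mathcal{F}\neq\emptyset$. Set systems $(E,\mathcal{F})$, $(E',\mathcal{F}')$ are isomorphic if there is a bijection $\phi:E\to E'$ with $A\in\mathcal{F}\iff\phi(A)\in\mathcal{F}'$. For proper $S$ and $e\in E$: $e$ is a loop if no feasible set contains $e$, a coloop if every feasible set contains $e$. If $e$ is not a loop, $S/e=(E-e,\{F-e:e\in F\in\mathcal{F}\})$; if $e$ is not a coloop, $S\backslash e=(E-e,\{F\in\mathcal{F}:e\notin F\})$; if $e$ is a loop or coloop, $S/e$ and $S\backslash e$ are both set equal to whichever was defined. A minor of $S$ is any set system obtained from $S$ by a (possibly empty) sequence of such operations. For $A\subseteq E$, the twist is $S*A=(E,\{F\triangle A:F\in\mathcal{F}\})$. A delta-matroid is a proper set system such that for all $X,Y\in\mathcal{F}$ and $u\in X\triangle Y$ there is $v\in X\triangle Y$ (possibly $v=u$) with $X\triangle\{u,v\}\in\mathcal{F}$. For $i\ge1$, $S_i=(\{e_1,\ldots,e_i\},\{\emptyset,\{e_1,\ldots,e_i\}\})$, and $\mathcal{S}$ is the set of all twists of $S_3,S_4,\ldots$. Let $T_1=(\{a,b,c\},\{\emptyset,\{a,b\},\{a,b,c\}\})$; $T_2=(\{a,b,c\},\{\emptyset,\{a,b\},\{a,c\},\{a,b,c\}\})$;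 $T_3=(\{a,b,c\},\{\emptyset,\{a\},\{a,b\},\{a,b,c\}\})$; $T_4=(\{a,b,c\},\{\emptyset,\{a\},\{a,b\},\{a,c\},\{a,b,c\}\})$; $T_5=(\{a,b,c,d\},\{\emptyset,\{a,b\},\{a,b,c,d\}\})$; $T_6=(\{a,b,c,d\},\{\emptyset,\{a,b\},\{a,c\},\{a,b,c,d\}\})$; $T_7=(\{a,b,c,d\},\{\emptyset,\{a,b\},\{a,c\},\{a,d\},\{a,b,c,d\}\})$; $T_8=(\{a,b,c,d\},\{\emptyset,\{a\},\{a,b\},\{a,c\},\{a,d\},\{a,b,c,d\}\})$. $\mathcal{T}$ is the set of all twists of $T_1,\ldots,T_8$. -}

module Defs where

open import Data.Nat using (ℕ; zero; suc; _≤_)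
open import Data.Bool using (Bool; true; false; _xor_)
open import Data.Fin using (Fin)
open import Data.Fin.Subset using (Subset; _∈_; _∉_; ⁅_⁆; _∪_)
open import Data.Vec using (Vec; []; _∷_; insertAt; zipWith; tabulate; lookup)
open import Data.Product using (Σ; ∃; ∃-syntax; _×_)
open import Data.Sum using (_⊎_)
open import Relation.Nullary using (¬_)
open import Relation.Binary.PropositionalEquality using (_≡_)
open import Function.Bundles using (_↔_; Inverse)

-- A set system on the ground set E = Fin n: the feasible sets are given by
-- their (decidable) characteristic function on subsets of E.
SetSystem : ℕ → Set
SetSystem n = Subset n → Bool

Feasible : ∀ {n} → SetSystem n → Subset n → Set
Feasible S X = S X ≡ true

Proper : ∀ {n} → SetSystem n → Set
Proper S = ∃[ X ] Feasible S X

_△_ : ∀ {n} → Subset n → Subset n → Subset n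
_△_ = zipWith _xor_

IsLoop : ∀ {n} → SetSystem n → Fin n → Set
IsLoop S e = ∀ X → Feasible S X → e ∉ X

IsColoop : ∀ {n} → SetSystem n → Fin n → Set
IsColoop S e = ∀ X → Feasible S X → e ∈ X

-- contraction S/e : feasible sets F - e with e ∈ F ∈ 𝓕, on ground set E - e
-- (E - e is identified with Fin n via the order-preserving embedding that skips e)
_／_ : ∀ {n} → SetSystem (suc n) → Fin (suc n) → SetSystem n
(S ／ e) X = S (insertAt X e true)

_∖_ : ∀ {n} → SetSystem (suc n) → Fin (suc n) → SetSystem n
(S ∖ e) X = S (insertAt X e false)

-- M is a minor of S: obtained by a (possibly empty) sequence of contractions of
-- non-loops and deletions of non-coloops (for a loop / coloop the paper's
-- convention makes S/e and S\e equal to the defined one, so these cover all steps).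
data Minor {m : ℕ} (M : SetSystem m) : ∀ {n} → SetSystem n → Set where
  here     : Minor M M
  contract : ∀ {n} {S : SetSystem (suc n)} (e : Fin (suc n)) →
             ¬ IsLoop S e → Minor M (S ／ e) → Minor M S
  delete   : ∀ {n} {S : SetSystem (suc n)} (e : Fin (suc n)) →
             ¬ IsColoop S e → Minor M (S ∖ e) → Minor M S

image : ∀ {n m} → (Fin n ↔ Fin m) → Subset n → Subset m
image φ A = tabulate (λ y → lookup A (Inverse.from φ y))

Isomorphic : ∀ {n m} → SetSystem n → SetSystem m → Set
Isomorphic {n} {m} S S' =
  Σ (Fin n ↔ Fin m) λ φ → ∀ A → (Feasible S A → Feasible S' (image φ A))
                              × (Feasible S' (image φ A) → Feasible S A)

_*_ : ∀ {n} → SetSystem n → Subset n → SetSystem n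
(S * A) X = S (X △ A)

-- the pair {u, v} (a singleton when u = v)
pair : ∀ {n} → Fin n → Fin n → Subset n
pair u v = ⁅ u ⁆ ∪ ⁅ v ⁆

IsDeltaMatroid : ∀ {n} → SetSystem n → Set
IsDeltaMatroid S =
  Proper S ×
  (∀ X Y → Feasible S X → Feasible S Y → ∀ u → u ∈ (X △ Y) →
     ∃[ v ] (v ∈ (X △ Y) × Feasible S (X △ pair u v)))

-- S_i on {e_1,...,e_i} (identified with Fin i): feasible sets ∅ and E
allFalse : ∀ {n} → Subset n → Bool
allFalse [] = true
allFalse (true ∷ _) = false
allFalse (false ∷ xs) = allFalse xs

allTrue : ∀ {n} → Subset n → Bool
allTrue [] = true
allTrue (false ∷ _) = false
allTrue (true ∷ xs) = allTrue xs

Sᵢ : (i : ℕ) → SetSystem i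
Sᵢ i X with allFalse X
... | true = true
... | false = allTrue X

-- T_1,...,T_8 with a,b,c,d = 0,1,2,3
T1 T2 T3 T4 : SetSystem 3
T1 (false ∷ false ∷ false ∷ []) = true
T1 (true ∷ true ∷ false ∷ []) = true
T1 (true ∷ true ∷ true ∷ []) = true
T1 _ = false

T2 (false ∷ false ∷ false ∷ []) = true
T2 (true ∷ true ∷ false ∷ []) = true
T2 (true ∷ false ∷ true ∷ []) = true
T2 (true ∷ true ∷ true ∷ []) = true
T2 _ = false

T3 (false ∷ false ∷ false ∷ []) = true
T3 (true ∷ false ∷ false ∷ []) = true
T3 (true ∷ true ∷ false ∷ []) = true
T3 (true ∷ true ∷ true ∷ []) = true
T3 _ = false

T4 (false ∷ false ∷ false ∷ []) = true
T4 (true ∷ false ∷ false ∷ []) = true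
T4 (true ∷ true ∷ false ∷ []) = true
T4 (true ∷ false ∷ true ∷ []) = true
T4 (true ∷ true ∷ true ∷ []) = true
T4 _ = false

T5 T6 T7 T8 : SetSystem 4
T5 (false ∷ false ∷ false ∷ false ∷ []) = true
T5 (true ∷ true ∷ false ∷ false ∷ []) = true
T5 (true ∷ true ∷ true ∷ true ∷ []) = true
T5 _ = false

T6 (false ∷ false ∷ false ∷ false ∷ []) = true
T6 (true ∷ true ∷ false ∷ false ∷ []) = true
T6 (true ∷ false ∷ true ∷ false ∷ []) = true
T6 (true ∷ true ∷ true ∷ true ∷ []) = true
T6 _ = false

T7 (false ∷ false ∷ false ∷ false ∷ []) = true
T7 (true ∷ true ∷ false ∷ false ∷ []) = true
T7 (true ∷ false ∷ true ∷ false ∷ []) = true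
T7 (true ∷ false ∷ false ∷ true ∷ []) = true
T7 (true ∷ true ∷ true ∷ true ∷ []) = true
T7 _ = false

T8 (false ∷ false ∷ false ∷ false ∷ []) = true
T8 (true ∷ false ∷ false ∷ false ∷ []) = true
T8 (true ∷ true ∷ false ∷ false ∷ []) = true
T8 (true ∷ false ∷ true ∷ false ∷ []) = true
T8 (true ∷ false ∷ false ∷ true ∷ []) = true
T8 (true ∷ true ∷ true ∷ true ∷ []) = true
T8 _ = false

In𝒮 : ∀ {m} → SetSystem m → Set
In𝒮 {m} X = Σ (3 ≤ m) λ _ → ∃[ A ] (∀ Y → X Y ≡ (Sᵢ m * A) Y)

data Is𝒯base : ∀ {m} → SetSystem m → Set where
  t1 : Is𝒯base T1
  t2 : Is𝒯base T2
  t3 : Is𝒯base T3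
  t4 : Is𝒯base T4
  t5 : Is𝒯base T5
  t6 : Is𝒯base T6
  t7 : Is𝒯base T7
  t8 : Is𝒯base T8

In𝒯 : ∀ {m} → SetSystem m → Set
In𝒯 {m} X = Σ (SetSystem m) λ T → Is𝒯base T × ∃[ A ] (∀ Y → X Y ≡ (T * A) Y)

HasBadMinor : ∀ {n} → SetSystem n → Set
HasBadMinor S =
  ∃[ m ] Σ (SetSystem m) λ M → Minor M S ×
  (∃[ k ] Σ (SetSystem k) λ X → (In𝒮 X ⊎ In𝒯 X) × Isomorphic M X)

-- Call (X, Y, u) a violation of S if X, Y are feasible, u ∈ X △ Y and no
-- X △ {u, v} with v ∈ X △ Y is feasible; a proper S is a delta-matroid iff it has none.
-- Violations of a minor lift to S, violations travel along isomorphisms and twists, and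
-- every member of 𝒮 ∪ 𝒯 has one, so delta-matroids have no minor in 𝒮 ∪ 𝒯.
-- Conversely, let S have a violation (X, Y, u). If some e lies outside X △ Y, the
-- violation survives in S/e (if e ∈ X) or S\e (if e ∉ X), and we induct on |E|. Otherwise
-- every violation of S has X △ Y = E; twisting by X and relabelling u to 0 gives a violation
-- (∅, E, 0), after which the only possible feasible sets are ∅, E and sets E − {0, v}.
-- For |E| ≥ 5 none of the E − {0, v} is feasible and S is a twist of S_|E|; for |E| = 3, 4
-- a finite check shows that S is isomorphic to a twist of S₃, S₄ or some Tᵢ, or else has
-- a violation with X △ Y ≠ E; |E| ≤ 2 is impossible.

module Submission where

open import Defs
open import Data.Bool using (Bool; true; false; _xor_; _∨_)
import Data.Bool as Bool
open import Data.Bool.Properties using (xor-assoc; xor-comm; xor-identityʳ; xor-same; true-xor; ¬-not)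
open import Data.Fin using (Fin; zero; suc; punchIn; #_)
open import Data.Fin.Permutation
  using (Permutation; transpose; _⟨$⟩ʳ_; _⟨$⟩ˡ_; inverseˡ; inverseʳ; flip; _∘ₚ_) renaming (id to idₚ)
open import Data.Fin.Properties using (_≟_; any?; all?; ¬∀⟶∃¬; punchIn-punchOut)
open import Data.Fin.Subset using (Subset; ⊥; ⊤; ⁅_⁆; _∪_; ∁; ∣_∣; _∈_; _∉_; _⊆_)
open import Data.Fin.Subset.Properties
  using (_∈?_; anySubset?; ∈⊤; ∉⊥; ⊆-antisym; ⊆⊤; x∈⁅x⁆; x∈⁅y⁆⇒x≡y; x∈p∪q⁺;
         x∈p⇒x∉∁p; x∉p⇒x∈∁p; p∪∁p≡⊤; ∣⊤∣≡n; ∣⁅x⁆∣≡1)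
open import Data.Nat using (ℕ; zero; suc; _+_; _≤_; _<_; z≤n; s≤s)
import Data.Nat.Properties as ℕ
open import Data.Product using (Σ; ∃; ∃-syntax; _×_; _,_; proj₁; proj₂)
open import Data.Sum using (_⊎_; inj₁; inj₂; [_,_]′)
open import Data.Vec using (Vec; []; _∷_; lookup; tabulate; zipWith; replicate; insertAt; removeAt)
open import Data.Vec.Properties
  using (≡-dec; zipWith-assoc; zipWith-comm; zipWith-identityʳ; lookup-zipWith; lookup-replicate;
         lookup∘tabulate; tabulate∘lookup; tabulate-cong; insertAt-lookup; insertAt-punchIn;
         insertAt-removeAt; []=⇒lookup; lookup⇒[]=)
open import Function using (_∘_)
open import Function.Bundles using (_⇔_; mk⇔; module Equivalence)
open import Relation.Binary.PropositionalEquality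
open import Relation.Nullary using (¬_; ¬?; Dec; does; yes; no; contradiction; _×-dec_; _→-dec_)
open import Relation.Nullary.Decidable
  using (True; False; toWitness; toWitnessFalse; from-yes; dec-true; decidable-stable; _⊎-dec_)
open ≡-Reasoning

private variable
  n : ℕ

lookup-ext : {X Y : Subset n} → (∀ i → lookup X i ≡ lookup Y i) → X ≡ Y
lookup-ext {X = X} {Y} eq = begin
  X                    ≡⟨ tabulate∘lookup X ⟨
  tabulate (lookup X)  ≡⟨ tabulate-cong eq ⟩
  tabulate (lookup Y)  ≡⟨ tabulate∘lookup Y ⟩
  Y                    ∎

△-assoc : (X Y Z : Subset n) → (X △ Y) △ Z ≡ X △ (Y △ Z)
△-assoc = zipWith-assoc xor-assoc

△-comm : (X Y : Subset n) → X △ Y ≡ Y △ X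
△-comm = zipWith-comm xor-comm

△-identityʳ : (X : Subset n) → X △ ⊥ ≡ X
△-identityʳ = zipWith-identityʳ xor-identityʳ

△-identityˡ : (X : Subset n) → ⊥ △ X ≡ X
△-identityˡ X = trans (△-comm ⊥ X) (△-identityʳ X)

△-self : (X : Subset n) → X △ X ≡ ⊥
△-self []      = refl
△-self (x ∷ X) = cong₂ _∷_ (xor-same x) (△-self X)

△-cancelʳ : (X A : Subset n) → (X △ A) △ A ≡ X
△-cancelʳ X A = begin
  (X △ A) △ A  ≡⟨ △-assoc X A A ⟩
  X △ (A △ A)  ≡⟨ cong (X △_) (△-self A) ⟩
  X △ ⊥        ≡⟨ △-identityʳ X ⟩
  X            ∎

△≡⇒≡△ : {X P Q : Subset n} → X △ P ≡ Q → X ≡ Q △ P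
△≡⇒≡△ {X = X} {P} X△P≡Q = trans (sym (△-cancelʳ X P)) (cong (_△ P) X△P≡Q)

△-twist : (X Y A : Subset n) → (X △ A) △ (Y △ A) ≡ X △ Y
△-twist X Y A = begin
  (X △ A) △ (Y △ A)  ≡⟨ cong ((X △ A) △_) (△-comm Y A) ⟩
  (X △ A) △ (A △ Y)  ≡⟨ △-assoc X A (A △ Y) ⟩
  X △ (A △ (A △ Y))  ≡⟨ cong (X △_) (△-assoc A A Y) ⟨
  X △ ((A △ A) △ Y)  ≡⟨ cong (λ B → X △ (B △ Y)) (△-self A) ⟩
  X △ (⊥ △ Y)        ≡⟨ cong (X △_) (△-identityˡ Y) ⟩
  X △ Y              ∎

⊤-△ : (X : Subset n) → ⊤ △ X ≡ ∁ X
⊤-△ []      = refl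
⊤-△ (x ∷ X) = cong₂ _∷_ (true-xor x) (⊤-△ X)

infix 4 _≟ₛ_

_≟ₛ_ : (X Y : Subset n) → Dec (X ≡ Y)
_≟ₛ_ = ≡-dec Bool._≟_

lookup-△ : (X Y : Subset n) (i : Fin n) → lookup (X △ Y) i ≡ lookup X i xor lookup Y i
lookup-△ X Y i = lookup-zipWith _xor_ i X Y

∉⇒lookup≡false : {x : Fin n} {X : Subset n} → x ∉ X → lookup X x ≡ false
∉⇒lookup≡false {x = x} {X} x∉X = ¬-not (x∉X ∘ lookup⇒[]= x X)

∈-△ʳ : {x : Fin n} {X Y : Subset n} → x ∉ X → x ∈ Y → x ∈ X △ Y
∈-△ʳ {x = x} {X} {Y} x∉X x∈Y = lookup⇒[]= x (X △ Y) (begin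
  lookup (X △ Y) x          ≡⟨ lookup-△ X Y x ⟩
  lookup X x xor lookup Y x ≡⟨ cong₂ _xor_ (∉⇒lookup≡false x∉X) ([]=⇒lookup x∈Y) ⟩
  true                      ∎)

∉-△⇒lookup≡ : {x : Fin n} {X Y : Subset n} → x ∉ X △ Y → lookup X x ≡ lookup Y x
∉-△⇒lookup≡ {x = x} {X} {Y} x∉ = xor≡false⇒≡ (trans (sym (lookup-△ X Y x)) (∉⇒lookup≡false x∉))
  where
  xor≡false⇒≡ : ∀ {a b} → a xor b ≡ false → a ≡ b
  xor≡false⇒≡ {false} {false} _ = refl
  xor≡false⇒≡ {true}  {true}  _ = refl

≢⊤⇒∃∉ : {X : Subset n} → X ≢ ⊤ → ∃ λ x → x ∉ X
≢⊤⇒∃∉ {n} {X} X≢⊤ = ¬∀⟶∃¬ n (_∈ X) (_∈? X) (λ all∈ → X≢⊤ (⊆-antisym ⊆⊤ (λ {x} _ → all∈ x)))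

∈-pairˡ : (u v : Fin n) → u ∈ pair u v
∈-pairˡ u v = x∈p∪q⁺ (inj₁ (x∈⁅x⁆ u))

∣p∪q∣≤∣p∣+∣q∣ : (p q : Subset n) → ∣ p ∪ q ∣ ≤ ∣ p ∣ + ∣ q ∣
∣p∪q∣≤∣p∣+∣q∣ []          []          = z≤n
∣p∪q∣≤∣p∣+∣q∣ (true  ∷ p) (true  ∷ q) =
  s≤s (ℕ.≤-trans (∣p∪q∣≤∣p∣+∣q∣ p q) (ℕ.+-monoʳ-≤ ∣ p ∣ (ℕ.n≤1+n ∣ q ∣)))
∣p∪q∣≤∣p∣+∣q∣ (true  ∷ p) (false ∷ q) = s≤s (∣p∪q∣≤∣p∣+∣q∣ p q)
∣p∪q∣≤∣p∣+∣q∣ (false ∷ p) (true  ∷ q) =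
  subst (suc ∣ p ∪ q ∣ ≤_) (sym (ℕ.+-suc ∣ p ∣ ∣ q ∣)) (s≤s (∣p∪q∣≤∣p∣+∣q∣ p q))
∣p∪q∣≤∣p∣+∣q∣ (false ∷ p) (false ∷ q) = ∣p∪q∣≤∣p∣+∣q∣ p q

∣pair∣≤2 : (u v : Fin n) → ∣ pair u v ∣ ≤ 2
∣pair∣≤2 u v = ℕ.≤-trans (∣p∪q∣≤∣p∣+∣q∣ ⁅ u ⁆ ⁅ v ⁆) (ℕ.≤-reflexive (cong₂ _+_ (∣⁅x⁆∣≡1 u) (∣⁅x⁆∣≡1 v)))

∣p∣<n⇒p≢⊤ : {p : Subset n} → ∣ p ∣ < n → p ≢ ⊤
∣p∣<n⇒p≢⊤ {n} ∣p∣<n refl = ℕ.<-irrefl (∣⊤∣≡n n) ∣p∣<n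

pair≢⊤ : 3 ≤ n → (u v : Fin n) → pair u v ≢ ⊤
pair≢⊤ 3≤n u v = ∣p∣<n⇒p≢⊤ (ℕ.<-≤-trans (s≤s (∣pair∣≤2 u v)) 3≤n)

pair≢∁pair : 5 ≤ n → (u v w z : Fin n) → pair u v ≢ ∁ (pair w z)
pair≢∁pair 5≤n u v w z P≡∁Q =
  ∣p∣<n⇒p≢⊤ ∣Q∪P∣<n (trans (cong (pair w z ∪_) P≡∁Q) (p∪∁p≡⊤ (pair w z)))
  where
  ∣Q∪P∣≤4 : ∣ pair w z ∪ pair u v ∣ ≤ 4
  ∣Q∪P∣≤4 = ℕ.≤-trans (∣p∪q∣≤∣p∣+∣q∣ (pair w z) (pair u v)) (ℕ.+-mono-≤ (∣pair∣≤2 w z) (∣pair∣≤2 u v))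
  ∣Q∪P∣<n : ∣ pair w z ∪ pair u v ∣ < _
  ∣Q∪P∣<n = ℕ.<-≤-trans (s≤s ∣Q∪P∣≤4) 5≤n

insertAt-zipWith : ∀ {A B C : Set} (f : A → B → C) (X : Vec A n) (Y : Vec B n) (e : Fin (suc n)) a b →
                   zipWith f (insertAt X e a) (insertAt Y e b) ≡ insertAt (zipWith f X Y) e (f a b)
insertAt-zipWith f X       Y       zero    a b = refl
insertAt-zipWith f (x ∷ X) (y ∷ Y) (suc e) a b = cong (f x y ∷_) (insertAt-zipWith f X Y e a b)

insertAt-replicate : ∀ {A : Set} (x : A) (e : Fin (suc n)) →
                     insertAt (replicate n x) e x ≡ replicate (suc n) x
insertAt-replicate {n}     x zero    = refl
insertAt-replicate {suc n} x (suc e) = cong (x ∷_) (insertAt-replicate x e)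

⁅⁆-punchIn : (e : Fin (suc n)) (u : Fin n) → ⁅ punchIn e u ⁆ ≡ insertAt ⁅ u ⁆ e false
⁅⁆-punchIn zero    u       = refl
⁅⁆-punchIn (suc e) zero    = cong (true ∷_) (sym (insertAt-replicate false e))
⁅⁆-punchIn (suc e) (suc u) = cong (false ∷_) (⁅⁆-punchIn e u)

insertAt-△-pair : (X : Subset n) (e : Fin (suc n)) (b : Bool) (u v : Fin n) →
                  insertAt X e b △ pair (punchIn e u) (punchIn e v) ≡ insertAt (X △ pair u v) e b
insertAt-△-pair X e b u v = begin
  insertAt X e b △ (⁅ punchIn e u ⁆ ∪ ⁅ punchIn e v ⁆)
    ≡⟨ cong (insertAt X e b △_) (cong₂ _∪_ (⁅⁆-punchIn e u) (⁅⁆-punchIn e v)) ⟩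
  insertAt X e b △ (insertAt ⁅ u ⁆ e false ∪ insertAt ⁅ v ⁆ e false)
    ≡⟨ cong (insertAt X e b △_) (insertAt-zipWith _∨_ ⁅ u ⁆ ⁅ v ⁆ e false false) ⟩
  insertAt X e b △ insertAt (pair u v) e false
    ≡⟨ insertAt-zipWith _xor_ X (pair u v) e b false ⟩
  insertAt (X △ pair u v) e (b xor false)
    ≡⟨ cong (insertAt (X △ pair u v) e) (xor-identityʳ b) ⟩
  insertAt (X △ pair u v) e b
    ∎

insertAt-△-same : (X Y : Subset n) (e : Fin (suc n)) (b : Bool) →
                  insertAt X e b △ insertAt Y e b ≡ insertAt (X △ Y) e false
insertAt-△-same X Y e b =
  trans (insertAt-zipWith _xor_ X Y e b b) (cong (insertAt (X △ Y) e) (xor-same b))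

∈-insertAt-punchIn⁺ : {X : Subset n} (e : Fin (suc n)) (b : Bool) {j : Fin n} →
                      j ∈ X → punchIn e j ∈ insertAt X e b
∈-insertAt-punchIn⁺ {X = X} e b {j} j∈X =
  lookup⇒[]= (punchIn e j) (insertAt X e b) (trans (insertAt-punchIn X e b j) ([]=⇒lookup j∈X))

∈-insertAt-punchIn⁻ : {X : Subset n} (e : Fin (suc n)) (b : Bool) {j : Fin n} →
                      punchIn e j ∈ insertAt X e b → j ∈ X
∈-insertAt-punchIn⁻ {X = X} e b {j} j∈ =
  lookup⇒[]= j X (trans (sym (insertAt-punchIn X e b j)) ([]=⇒lookup j∈))

∉-insertAt-false : (X : Subset n) (e : Fin (suc n)) → e ∉ insertAt X e false
∉-insertAt-false X e e∈ with () ← trans (sym (insertAt-lookup X e false)) ([]=⇒lookup e∈)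

punchIn-or-pivot : (e i : Fin (suc n)) → i ≡ e ⊎ ∃ λ j → punchIn e j ≡ i
punchIn-or-pivot e i with i ≟ e
... | yes i≡e = inj₁ i≡e
... | no  i≢e = inj₂ (_ , punchIn-punchOut (i≢e ∘ sym))

Violation : SetSystem n → Subset n → Subset n → Fin n → Set
Violation S X Y u =
  Feasible S X × Feasible S Y × u ∈ X △ Y × (∀ v → v ∈ X △ Y → ¬ Feasible S (X △ pair u v))

HasViolation : SetSystem n → Set
HasViolation S = ∃ λ X → ∃ λ Y → ∃ λ u → Violation S X Y u

feasible? : (S : SetSystem n) (X : Subset n) → Dec (Feasible S X)
feasible? S X = S X Bool.≟ true

violation? : (S : SetSystem n) (X Y : Subset n) (u : Fin n) → Dec (Violation S X Y u)
violation? S X Y u = feasible? S X ×-dec feasible? S Y ×-dec u ∈? X △ Y ×-dec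
                     all? (λ v → v ∈? X △ Y →-dec ¬? (feasible? S (X △ pair u v)))

isDeltaMatroid⇔noViolation : (S : SetSystem n) → IsDeltaMatroid S ⇔ (Proper S × ¬ HasViolation S)
isDeltaMatroid⇔noViolation S = mk⇔
  (λ (proper , exchange) → proper , λ (X , Y , u , fX , fY , u∈ , blocked) →
     let v , v∈ , fv = exchange X Y fX fY u u∈ in blocked v v∈ fv)
  (λ (proper , noViolation) → proper , exchange noViolation)
  where
  exchange : ¬ HasViolation S → ∀ X Y → Feasible S X → Feasible S Y → ∀ u → u ∈ X △ Y →
             ∃[ v ] (v ∈ X △ Y × Feasible S (X △ pair u v))
  exchange noViolation X Y fX fY u u∈ with any? (λ v → v ∈? X △ Y ×-dec feasible? S (X △ pair u v))
  ... | yes found = found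
  ... | no  none  = contradiction (X , Y , u , fX , fY , u∈ , λ v v∈ fv → none (v , v∈ , fv)) noViolation

violation-resp-≗ : {S S′ : SetSystem n} → (∀ Z → S Z ≡ S′ Z) → ∀ {X Y u} →
                   Violation S X Y u → Violation S′ X Y u
violation-resp-≗ S≗S′ {X} {Y} (fX , fY , u∈ , blocked) =
  trans (sym (S≗S′ X)) fX , trans (sym (S≗S′ Y)) fY , u∈ , λ v v∈ f → blocked v v∈ (trans (S≗S′ _) f)

violation-twist : {S : SetSystem n} (A : Subset n) → ∀ {X Y u} →
                  Violation S X Y u → Violation (S * A) (X △ A) (Y △ A) u
violation-twist {S = S} A {X} {Y} (fX , fY , u∈ , blocked) =
  subst (Feasible S) (sym (△-cancelʳ X A)) fX ,
  subst (Feasible S) (sym (△-cancelʳ Y A)) fY ,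
  subst (_ ∈_) (sym (△-twist X Y A)) u∈ ,
  λ v v∈ f → blocked v (subst (v ∈_) (△-twist X Y A) v∈) (subst (Feasible S) (twisted-pair v) f)
  where
  twisted-pair : ∀ v → ((X △ A) △ pair _ v) △ A ≡ X △ pair _ v
  twisted-pair v = begin
    ((X △ A) △ P) △ A  ≡⟨ cong (_△ A) (△-assoc X A P) ⟩
    (X △ (A △ P)) △ A  ≡⟨ cong (λ B → (X △ B) △ A) (△-comm A P) ⟩
    (X △ (P △ A)) △ A  ≡⟨ cong (_△ A) (△-assoc X P A) ⟨
    ((X △ P) △ A) △ A  ≡⟨ △-cancelʳ (X △ P) A ⟩
    X △ P              ∎
    where P = pair _ v

violation-insertAt⁺ : {S : SetSystem (suc n)} (e : Fin (suc n)) (b : Bool) → ∀ {X Y u} →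
                      Violation (λ Z → S (insertAt Z e b)) X Y u →
                      Violation S (insertAt X e b) (insertAt Y e b) (punchIn e u)
violation-insertAt⁺ {S = S} e b {X} {Y} {u} (fX , fY , u∈ , blocked) =
  fX , fY , subst (_ ∈_) (sym (insertAt-△-same X Y e b)) (∈-insertAt-punchIn⁺ e false u∈) ,
  λ v v∈ → blocked′ v (subst (v ∈_) (insertAt-△-same X Y e b) v∈)
  where
  blocked′ : ∀ v → v ∈ insertAt (X △ Y) e false → ¬ Feasible S (insertAt X e b △ pair (punchIn e u) v)
  blocked′ v v∈ with punchIn-or-pivot e v
  ... | inj₁ refl       = contradiction v∈ (∉-insertAt-false (X △ Y) e)
  ... | inj₂ (j , refl) =
    blocked j (∈-insertAt-punchIn⁻ e false v∈) ∘ subst (Feasible S) (insertAt-△-pair X e b u j)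

violation-insertAt⁻ : {S : SetSystem (suc n)} (e : Fin (suc n)) (b : Bool) → ∀ {X Y u} →
                      Violation S (insertAt X e b) (insertAt Y e b) (punchIn e u) →
                      Violation (λ Z → S (insertAt Z e b)) X Y u
violation-insertAt⁻ {S = S} e b {X} {Y} {u} (fX , fY , u∈ , blocked) =
  fX , fY , ∈-insertAt-punchIn⁻ e false (subst (_ ∈_) (insertAt-△-same X Y e b) u∈) ,
  λ j j∈ → blocked (punchIn e j)
                   (subst (_ ∈_) (sym (insertAt-△-same X Y e b)) (∈-insertAt-punchIn⁺ e false j∈))
           ∘ subst (Feasible S) (sym (insertAt-△-pair X e b u j))

minor-violation : ∀ {m} {M : SetSystem m} {S : SetSystem n} → Minor M S → HasViolation M → HasViolation S
minor-violation here                      viol = viol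
minor-violation {S = S} (contract e _ M≼) viol with minor-violation M≼ viol
... | _ , _ , _ , v = _ , _ , _ , violation-insertAt⁺ {S = S} e true v
minor-violation {S = S} (delete e _ M≼)   viol with minor-violation M≼ viol
... | _ , _ , _ , v = _ , _ , _ , violation-insertAt⁺ {S = S} e false v

violation-removeAt : {S : SetSystem (suc n)} {X Y : Subset (suc n)} {u : Fin n} (e : Fin (suc n)) →
                     e ∉ X △ Y → Violation S X Y (punchIn e u) →
                     Violation (λ Z → S (insertAt Z e (lookup X e))) (removeAt X e) (removeAt Y e) u
violation-removeAt {S = S} {X} {Y} e e∉ viol = violation-insertAt⁻ {S = S} e (lookup X e)
  (subst₂ (λ X′ Y′ → Violation S X′ Y′ _) (sym (insertAt-removeAt X e)) (sym Y≡) viol)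
  where
  Y≡ : insertAt (removeAt Y e) e (lookup X e) ≡ Y
  Y≡ = trans (cong (insertAt (removeAt Y e) e) (∉-△⇒lookup≡ e∉)) (insertAt-removeAt Y e)

violation-shrink : {S : SetSystem (suc n)} {X Y : Subset (suc n)} {u : Fin (suc n)} →
                   Violation S X Y u → (e : Fin (suc n)) → e ∉ X △ Y →
                   Σ (SetSystem n) λ S′ →
                     (∀ {m} {M : SetSystem m} → Minor M S′ → Minor M S) × HasViolation S′
violation-shrink {S = S} {X} {Y} {u} viol@(fX , _ , u∈ , _) e e∉
  with punchIn-or-pivot e u | lookup X e in Xe
... | inj₁ refl        | _     = contradiction u∈ e∉
... | inj₂ (u′ , refl) | true  =
  S ／ e , contract e (λ loop → loop X fX (lookup⇒[]= e X Xe)) ,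
  subst (λ b → HasViolation (λ Z → S (insertAt Z e b))) Xe (_ , _ , _ , violation-removeAt {S = S} e e∉ viol)
... | inj₂ (u′ , refl) | false =
  S ∖ e , delete e (λ coloop → contradiction (trans (sym ([]=⇒lookup (coloop X fX))) Xe) λ ()) ,
  subst (λ b → HasViolation (λ Z → S (insertAt Z e b))) Xe (_ , _ , _ , violation-removeAt {S = S} e e∉ viol)

module _ {m : ℕ} (φ : Permutation n m) where

  lookup-image : (A : Subset n) (y : Fin m) → lookup (image φ A) y ≡ lookup A (φ ⟨$⟩ˡ y)
  lookup-image A y = lookup∘tabulate _ y

  ∈-image⁺ : {A : Subset n} {y : Fin m} → φ ⟨$⟩ˡ y ∈ A → y ∈ image φ A
  ∈-image⁺ {A} {y} x∈ = lookup⇒[]= y (image φ A) (trans (lookup-image A y) ([]=⇒lookup x∈))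

  ∈-image⁻ : {A : Subset n} {y : Fin m} → y ∈ image φ A → φ ⟨$⟩ˡ y ∈ A
  ∈-image⁻ {A} {y} y∈ = lookup⇒[]= _ A (trans (sym (lookup-image A y)) ([]=⇒lookup y∈))

  image-zipWith : (f : Bool → Bool → Bool) (A B : Subset n) →
                  image φ (zipWith f A B) ≡ zipWith f (image φ A) (image φ B)
  image-zipWith f A B = lookup-ext λ y → begin
    lookup (image φ (zipWith f A B)) y               ≡⟨ lookup-image (zipWith f A B) y ⟩
    lookup (zipWith f A B) (φ ⟨$⟩ˡ y)                ≡⟨ lookup-zipWith f _ A B ⟩
    f (lookup A (φ ⟨$⟩ˡ y)) (lookup B (φ ⟨$⟩ˡ y))    ≡⟨ cong₂ f (lookup-image A y) (lookup-image B y) ⟨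
    f (lookup (image φ A) y) (lookup (image φ B) y)  ≡⟨ lookup-zipWith f y (image φ A) (image φ B) ⟨
    lookup (zipWith f (image φ A) (image φ B)) y     ∎

  image-replicate : (b : Bool) → image φ (replicate n b) ≡ replicate m b
  image-replicate b = lookup-ext λ y →
    trans (lookup-image (replicate n b) y)
          (trans (lookup-replicate (φ ⟨$⟩ˡ y) b) (sym (lookup-replicate y b)))

  image-⁅⁆ : (u : Fin n) → image φ ⁅ u ⁆ ≡ ⁅ φ ⟨$⟩ʳ u ⁆
  image-⁅⁆ u = ⊆-antisym image⊆ ⊆image
    where
    image⊆ : image φ ⁅ u ⁆ ⊆ ⁅ φ ⟨$⟩ʳ u ⁆
    image⊆ {y} y∈ = subst (_∈ ⁅ φ ⟨$⟩ʳ u ⁆) to-u≡y (x∈⁅x⁆ (φ ⟨$⟩ʳ u))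
      where
      to-u≡y : φ ⟨$⟩ʳ u ≡ y
      to-u≡y = trans (cong (φ ⟨$⟩ʳ_) (sym (x∈⁅y⁆⇒x≡y u (∈-image⁻ y∈)))) (inverseʳ φ)
    ⊆image : ⁅ φ ⟨$⟩ʳ u ⁆ ⊆ image φ ⁅ u ⁆
    ⊆image y∈ with refl ← x∈⁅y⁆⇒x≡y _ y∈ = ∈-image⁺ (subst (_∈ ⁅ u ⁆) (sym (inverseˡ φ)) (x∈⁅x⁆ u))

  image-△-pair : (X : Subset n) (u : Fin n) (v : Fin m) →
                 image φ (X △ pair u (φ ⟨$⟩ˡ v)) ≡ image φ X △ pair (φ ⟨$⟩ʳ u) v
  image-△-pair X u v = begin
    image φ (X △ pair u (φ ⟨$⟩ˡ v))
      ≡⟨ image-zipWith _xor_ X _ ⟩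
    image φ X △ image φ (⁅ u ⁆ ∪ ⁅ φ ⟨$⟩ˡ v ⁆)
      ≡⟨ cong (image φ X △_) (image-zipWith _∨_ ⁅ u ⁆ _) ⟩
    image φ X △ (image φ ⁅ u ⁆ ∪ image φ ⁅ φ ⟨$⟩ˡ v ⁆)
      ≡⟨ cong (image φ X △_) (cong₂ _∪_ (image-⁅⁆ u) (trans (image-⁅⁆ _) (cong ⁅_⁆ (inverseʳ φ)))) ⟩
    image φ X △ pair (φ ⟨$⟩ʳ u) v
      ∎

  image-flip-image : (A : Subset n) → image (flip φ) (image φ A) ≡ A
  image-flip-image A = lookup-ext λ x →
    trans (lookup∘tabulate _ x) (trans (lookup-image A _) (cong (lookup A) (inverseˡ φ)))

image-id : (A : Subset n) → image idₚ A ≡ A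
image-id = tabulate∘lookup

image-∘ₚ : ∀ {m k} (φ : Permutation n m) (ψ : Permutation m k) (A : Subset n) →
           image (φ ∘ₚ ψ) A ≡ image ψ (image φ A)
image-∘ₚ φ ψ A = lookup-ext λ z →
  trans (lookup-image (φ ∘ₚ ψ) A z) (sym (trans (lookup-image ψ (image φ A) z) (lookup-image φ A _)))

isomorphic : ∀ {m} {S : SetSystem n} {S′ : SetSystem m} (φ : Permutation n m) →
             (∀ A → S A ≡ S′ (image φ A)) → Isomorphic S S′
isomorphic φ S≡S′∘φ = φ , λ A → (λ f → trans (sym (S≡S′∘φ A)) f) , (λ f → trans (S≡S′∘φ A) f)

isomorphic-sym : ∀ {m} {S : SetSystem n} {S′ : SetSystem m} → Isomorphic S S′ → Isomorphic S′ S
isomorphic-sym {S = S} {S′} (φ , iso) = flip φ , λ B →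
  (λ f → proj₂ (iso _) (subst (Feasible S′) (sym (image-flip-image (flip φ) B)) f)) ,
  (λ f → subst (Feasible S′) (image-flip-image (flip φ) B) (proj₁ (iso _) f))

isomorphic-trans : ∀ {m k} {S : SetSystem n} {S′ : SetSystem m} {S″ : SetSystem k} →
                   Isomorphic S S′ → Isomorphic S′ S″ → Isomorphic S S″
isomorphic-trans {S″ = S″} (φ , iso) (ψ , iso′) = φ ∘ₚ ψ , λ A →
  (λ f → subst (Feasible S″) (sym (image-∘ₚ φ ψ A)) (proj₁ (iso′ _) (proj₁ (iso A) f))) ,
  (λ f → proj₂ (iso A) (proj₂ (iso′ _) (subst (Feasible S″) (image-∘ₚ φ ψ A) f)))

violation-transport : ∀ {m} {S : SetSystem n} {S′ : SetSystem m} ((φ , _) : Isomorphic S S′) →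
                      ∀ {X Y u} → Violation S X Y u → Violation S′ (image φ X) (image φ Y) (φ ⟨$⟩ʳ u)
violation-transport {S = S} {S′} (φ , iso) {X} {Y} {u} (fX , fY , u∈ , blocked) =
  proj₁ (iso X) fX , proj₁ (iso Y) fY ,
  subst (_ ∈_) (image-zipWith φ _xor_ X Y) (∈-image⁺ φ (subst (_∈ X △ Y) (sym (inverseˡ φ)) u∈)) ,
  λ v v∈ f → blocked (φ ⟨$⟩ˡ v)
    (∈-image⁻ φ (subst (v ∈_) (sym (image-zipWith φ _xor_ X Y)) v∈))
    (proj₂ (iso _) (subst (Feasible S′) (sym (image-△-pair φ X u v)) f))

hasViolation-transport : ∀ {m} {S : SetSystem n} {S′ : SetSystem m} →
                         Isomorphic S S′ → HasViolation S → HasViolation S′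
hasViolation-transport {S = S} {S′} S≅S′ (_ , _ , _ , viol) =
  _ , _ , _ , violation-transport {S = S} {S′} S≅S′ viol

allFalse⇒≡⊥ : (Z : Subset n) → allFalse Z ≡ true → Z ≡ ⊥
allFalse⇒≡⊥ []          _ = refl
allFalse⇒≡⊥ (false ∷ Z) h = cong (false ∷_) (allFalse⇒≡⊥ Z h)

allTrue⇒≡⊤ : (Z : Subset n) → allTrue Z ≡ true → Z ≡ ⊤
allTrue⇒≡⊤ []         _ = refl
allTrue⇒≡⊤ (true ∷ Z) h = cong (true ∷_) (allTrue⇒≡⊤ Z h)

allFalse-⊥ : ∀ n → allFalse (⊥ {n}) ≡ true
allFalse-⊥ zero    = refl
allFalse-⊥ (suc n) = allFalse-⊥ n

allTrue-⊤ : ∀ n → allTrue (⊤ {n}) ≡ true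
allTrue-⊤ zero    = refl
allTrue-⊤ (suc n) = allTrue-⊤ n

Sᵢ-feasible⁻ : (Z : Subset n) → Feasible (Sᵢ n) Z → Z ≡ ⊥ ⊎ Z ≡ ⊤
Sᵢ-feasible⁻ Z f with allFalse Z in Z∅
... | true  = inj₁ (allFalse⇒≡⊥ Z Z∅)
... | false = inj₂ (allTrue⇒≡⊤ Z f)

Sᵢ-feasible⁺ : ∀ n {Z : Subset n} → Z ≡ ⊥ ⊎ Z ≡ ⊤ → Feasible (Sᵢ n) Z
Sᵢ-feasible⁺ n (inj₁ refl) rewrite allFalse-⊥ n = refl
Sᵢ-feasible⁺ n (inj₂ refl) with allFalse (⊤ {n})
... | true  = refl
... | false = allTrue-⊤ n

Sᵢ-violation : 3 ≤ n → (u : Fin n) → Violation (Sᵢ n) ⊥ ⊤ u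
Sᵢ-violation {n} 3≤n u =
  Sᵢ-feasible⁺ n (inj₁ refl) , Sᵢ-feasible⁺ n (inj₂ refl) , subst (u ∈_) (sym (△-identityˡ ⊤)) ∈⊤ ,
  λ v _ f → [ (λ P≡⊥ → ∉⊥ (subst (u ∈_) P≡⊥ (∈-pairˡ u v))) , pair≢⊤ 3≤n u v ]′
              (Sᵢ-feasible⁻ _ (subst (Feasible (Sᵢ n)) (△-identityˡ (pair u v)) f))

Target : ∀ {k} → SetSystem k → Set
Target X = In𝒮 X ⊎ In𝒯 X

Sᵢ-target : 3 ≤ n → Target (Sᵢ n)
Sᵢ-target {n} 3≤n = inj₁ (3≤n , ⊥ , λ Y → cong (Sᵢ n) (sym (△-identityʳ Y)))

IsomorphicToTarget : SetSystem n → Set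
IsomorphicToTarget M = ∃[ k ] Σ (SetSystem k) λ X → Target X × Isomorphic M X

target-twist : ∀ {k} {X : SetSystem k} (C : Subset k) → Target X → Target (X * C)
target-twist {k} C (inj₁ (3≤k , A , X≗)) =
  inj₁ (3≤k , C △ A , λ Y → trans (X≗ (Y △ C)) (cong (Sᵢ k) (△-assoc Y C A)))
target-twist C (inj₂ (T , base , A , X≗)) =
  inj₂ (T , base , C △ A , λ Y → trans (X≗ (Y △ C)) (cong T (△-assoc Y C A)))

isomorphicToTarget-resp : ∀ {m} {S : SetSystem n} {S′ : SetSystem m} →
                          Isomorphic S S′ → IsomorphicToTarget S′ → IsomorphicToTarget S
isomorphicToTarget-resp {S′ = S′} S≅S′ (k , X , target , S′≅X) =
  k , X , target , isomorphic-trans {S′ = S′} {X} S≅S′ S′≅X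

isomorphicToTarget-twist : {S : SetSystem n} (A : Subset n) →
                           IsomorphicToTarget (S * A) → IsomorphicToTarget S
isomorphicToTarget-twist {S = S} A (k , X , target , φ , iso) =
  k , X * image φ A , target-twist (image φ A) target , φ , λ Z →
    (λ f → subst (Feasible X) (image-zipWith φ _xor_ Z A)
                 (proj₁ (iso (Z △ A)) (subst (Feasible S) (sym (△-cancelʳ Z A)) f))) ,
    (λ f → subst (Feasible S) (△-cancelʳ Z A)
                 (proj₂ (iso (Z △ A)) (subst (Feasible X) (sym (image-zipWith φ _xor_ Z A)) f)))

hasViolation? : (S : SetSystem n) → Dec (HasViolation S)
hasViolation? S = anySubset? λ X → anySubset? λ Y → any? λ u → violation? S X Y u

base-violation : ∀ {k} {T : SetSystem k} → Is𝒯base T → HasViolation T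
base-violation t1 = from-yes (hasViolation? T1)
base-violation t2 = from-yes (hasViolation? T2)
base-violation t3 = from-yes (hasViolation? T3)
base-violation t4 = from-yes (hasViolation? T4)
base-violation t5 = from-yes (hasViolation? T5)
base-violation t6 = from-yes (hasViolation? T6)
base-violation t7 = from-yes (hasViolation? T7)
base-violation t8 = from-yes (hasViolation? T8)

target-violation : ∀ {k} {X : SetSystem k} → Target X → HasViolation X
target-violation (inj₁ (3≤k@(s≤s _) , A , X≗)) =
  _ , _ , _ , violation-resp-≗ (sym ∘ X≗) (violation-twist {S = Sᵢ _} A (Sᵢ-violation 3≤k zero))
target-violation (inj₂ (T , base , A , X≗)) with base-violation base
... | _ , _ , _ , viol = _ , _ , _ , violation-resp-≗ (sym ∘ X≗) (violation-twist {S = T} A viol)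

noViolation⇒noBadMinor : {S : SetSystem n} → ¬ HasViolation S → ¬ HasBadMinor S
noViolation⇒noBadMinor noViolation (_ , _ , M≼S , _ , _ , target , M≅X) =
  noViolation (minor-violation M≼S (hasViolation-transport (isomorphic-sym M≅X) (target-violation target)))

Spanning : SetSystem n → Set
Spanning S = ∀ X Y u → Violation S X Y u → X △ Y ≡ ⊤

spanning-transport : ∀ {m} {S : SetSystem n} {S′ : SetSystem m} → Isomorphic S S′ → Spanning S → Spanning S′
spanning-transport {S = S} {S′} S≅S′@(φ , _) spanning A B w viol = begin
  A △ B                    ≡⟨ cong₂ _△_ (image-flip-image (flip φ) A) (image-flip-image (flip φ) B) ⟨
  image φ A′ △ image φ B′  ≡⟨ image-zipWith φ _xor_ A′ B′ ⟨
  image φ (A′ △ B′)        ≡⟨ cong (image φ) (spanning A′ B′ _ viol′) ⟩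
  image φ ⊤                ≡⟨ image-replicate φ true ⟩
  ⊤                        ∎
  where
  A′ = image (flip φ) A
  B′ = image (flip φ) B
  viol′ = violation-transport {S = S′} {S} (isomorphic-sym S≅S′) viol

spanning-twist : {S : SetSystem n} (A : Subset n) → Spanning S → Spanning (S * A)
spanning-twist {S = S} A spanning X Y u viol = trans (sym (△-twist X Y A))
  (spanning _ _ _ (violation-resp-≗ (λ Z → cong S (△-cancelʳ Z A)) (violation-twist {S = S * A} A viol)))

does≡true⇒ : ∀ {P : Set} (P? : Dec P) → does P? ≡ true → P
does≡true⇒ (yes p) _ = p

sameFeasible⇒isomorphic : ∀ {S S′ : SetSystem n} →
                          (∀ A → (Feasible S A → Feasible S′ A) × (Feasible S′ A → Feasible S A)) →
                          Isomorphic S S′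
sameFeasible⇒isomorphic {S′ = S′} S≐S′ = idₚ , λ A →
  (λ f → subst (Feasible S′) (sym (image-id A)) (proj₁ (S≐S′ A) f)) ,
  (λ f → proj₂ (S≐S′ A) (subst (Feasible S′) (image-id A) f))

normalForm : Fin n → Vec Bool n → SetSystem n
normalForm u V Z =
  does (Z ≟ₛ ⊥ ⊎-dec Z ≟ₛ ⊤ ⊎-dec any? λ v → (lookup V v Bool.≟ true) ×-dec Z ≟ₛ ∁ (pair u v))

complementedPairs : SetSystem n → Fin n → Vec Bool n
complementedPairs N u = tabulate λ v → N (∁ (pair u v))

module _ {N : SetSystem n} {u : Fin n} (spanning : Spanning N) (viol : Violation N ⊥ ⊤ u) where

  private
    N⊥ : Feasible N ⊥
    N⊥ = proj₁ viol

    N⊤ : Feasible N ⊤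
    N⊤ = proj₁ (proj₂ viol)

  pair-infeasible : ∀ v → ¬ Feasible N (pair u v)
  pair-infeasible v = proj₂ (proj₂ (proj₂ viol)) v (subst (v ∈_) (sym (△-identityˡ ⊤)) ∈⊤)
                      ∘ subst (Feasible N) (sym (△-identityˡ (pair u v)))

  feasible-∋pivot⇒⊤ : {Z : Subset n} → Feasible N Z → u ∈ Z → Z ≡ ⊤
  feasible-∋pivot⇒⊤ {Z} fZ u∈Z = trans (sym (△-identityˡ Z)) (spanning ⊥ Z u
    (N⊥ , fZ , subst (u ∈_) (sym (△-identityˡ Z)) u∈Z ,
     λ v _ → pair-infeasible v ∘ subst (Feasible N) (△-identityˡ (pair u v))))

  feasible-shape : {Z : Subset n} → Feasible N Z → Z ≡ ⊥ ⊎ Z ≡ ⊤ ⊎ ∃ λ v → Z ≡ ∁ (pair u v)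
  feasible-shape {Z} fZ with u ∈? Z
  ... | yes u∈Z = inj₂ (inj₁ (feasible-∋pivot⇒⊤ fZ u∈Z))
  ... | no  u∉Z with any? (λ v → feasible? N (Z △ pair u v))
  ...   | yes (v , f) = inj₂ (inj₂ (v , trans (△≡⇒≡△ Z△P≡⊤) (⊤-△ (pair u v))))
    where
    Z△P≡⊤ : Z △ pair u v ≡ ⊤
    Z△P≡⊤ = feasible-∋pivot⇒⊤ f (∈-△ʳ u∉Z (∈-pairˡ u v))
  ...   | no  none    = inj₁ (trans (△≡⇒≡△ Z△⊤≡⊤) (△-self ⊤))
    where
    Z△⊤≡⊤ : Z △ ⊤ ≡ ⊤
    Z△⊤≡⊤ = spanning Z ⊤ u (fZ , N⊤ , ∈-△ʳ u∉Z ∈⊤ , λ v _ f → none (v , f))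

  -- If E − {u, v} were feasible, then for w ∉ {u, v} the triple (∅, E − {u, v}, w) would be a
  -- violation whose difference misses u: for |E| ≥ 5 no pair {w, z} is ∅, E or some E − {u, z′}.
  complementedPair-infeasible : 5 ≤ n → ∀ v → ¬ Feasible N (∁ (pair u v))
  complementedPair-infeasible 5≤n v fZ =
    x∈p⇒x∉∁p (∈-pairˡ u v) (subst (u ∈_) (sym Z≡⊤) ∈⊤)
    where
    3≤n : 3 ≤ n
    3≤n = ℕ.≤-trans (s≤s (s≤s (s≤s z≤n))) 5≤n
    w∉ : ∃ λ w → w ∉ pair u v
    w∉ = ≢⊤⇒∃∉ (pair≢⊤ 3≤n u v)
    w = proj₁ w∉
    pair-w-infeasible : ∀ z → ¬ Feasible N (pair w z)
    pair-w-infeasible z f with feasible-shape f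
    ... | inj₁ P≡⊥               = ∉⊥ (subst (w ∈_) P≡⊥ (∈-pairˡ w z))
    ... | inj₂ (inj₁ P≡⊤)        = pair≢⊤ 3≤n w z P≡⊤
    ... | inj₂ (inj₂ (z′ , P≡∁)) = pair≢∁pair 5≤n w z u z′ P≡∁
    Z≡⊤ : ∁ (pair u v) ≡ ⊤
    Z≡⊤ = trans (sym (△-identityˡ _)) (spanning ⊥ _ w
      (N⊥ , fZ , subst (w ∈_) (sym (△-identityˡ _)) (x∉p⇒x∈∁p (proj₂ w∉)) ,
       λ z _ → pair-w-infeasible z ∘ subst (Feasible N) (△-identityˡ (pair w z))))

  isomorphic-normalForm : Isomorphic N (normalForm u (complementedPairs N u))
  isomorphic-normalForm = sameFeasible⇒isomorphic λ Z →
    (λ fZ → dec-true (shape? Z) (shape fZ)) , (feasible ∘ does≡true⇒ (shape? Z))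
    where
    V = complementedPairs N u
    shape? : (Z : Subset n) → Dec _
    shape? Z = Z ≟ₛ ⊥ ⊎-dec Z ≟ₛ ⊤ ⊎-dec any? λ v → (lookup V v Bool.≟ true) ×-dec Z ≟ₛ ∁ (pair u v)
    shape : {Z : Subset n} → Feasible N Z → Z ≡ ⊥ ⊎ Z ≡ ⊤ ⊎ ∃ λ v → lookup V v ≡ true × Z ≡ ∁ (pair u v)
    shape fZ with feasible-shape fZ
    ... | inj₁ Z≡⊥              = inj₁ Z≡⊥
    ... | inj₂ (inj₁ Z≡⊤)       = inj₂ (inj₁ Z≡⊤)
    ... | inj₂ (inj₂ (v , refl)) = inj₂ (inj₂ (v , trans (lookup∘tabulate _ v) fZ , refl))
    feasible : {Z : Subset n} → Z ≡ ⊥ ⊎ Z ≡ ⊤ ⊎ ∃ (λ v → lookup V v ≡ true × Z ≡ ∁ (pair u v)) →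
               Feasible N Z
    feasible (inj₁ refl)                  = N⊥
    feasible (inj₂ (inj₁ refl))           = N⊤
    feasible (inj₂ (inj₂ (v , Vv , refl))) = trans (sym (lookup∘tabulate _ v)) Vv

  isomorphic-Sᵢ : 5 ≤ n → Isomorphic N (Sᵢ n)
  isomorphic-Sᵢ 5≤n = sameFeasible⇒isomorphic λ Z →
    (λ fZ → Sᵢ-feasible⁺ n (trivial (feasible-shape fZ) fZ)) ,
    (λ f → [ (λ { refl → N⊥ }) , (λ { refl → N⊤ }) ]′ (Sᵢ-feasible⁻ Z f))
    where
    trivial : {Z : Subset n} → Z ≡ ⊥ ⊎ Z ≡ ⊤ ⊎ ∃ (λ v → Z ≡ ∁ (pair u v)) → Feasible N Z →
              Z ≡ ⊥ ⊎ Z ≡ ⊤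
    trivial (inj₁ Z≡⊥)              _  = inj₁ Z≡⊥
    trivial (inj₂ (inj₁ Z≡⊤))       _  = inj₂ Z≡⊤
    trivial (inj₂ (inj₂ (v , refl))) fZ = contradiction fZ (complementedPair-infeasible 5≤n v)

all-subsets? : {P : Subset n → Set} → (∀ A → Dec (P A)) → Dec (∀ A → P A)
all-subsets? P? with anySubset? (¬? ∘ P?)
... | yes (A , ¬PA) = no λ all → ¬PA (all A)
... | no  none      = yes λ A → decidable-stable (P? A) λ ¬PA → none (A , ¬PA)

𝒯-twist : ∀ {k} {T : SetSystem k} → Is𝒯base T → (C : Subset k) → Target (T * C)
𝒯-twist {T = T} base C = inj₂ (T , base , C , λ _ → refl)

via : ∀ {k} {P X : SetSystem k} → Target X → (π : Permutation k k) →
      {True (all-subsets? λ A → P A Bool.≟ X (image π A))} → IsomorphicToTarget P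
via {P = P} {X} target π {P≡X∘π} = _ , X , target , isomorphic {S = P} {X} π (toWitness P≡X∘π)

refuted : ∀ {k} {P : SetSystem k} (X Y : Subset k) (w : Fin k) →
          {True (violation? P X Y w)} → {False (X △ Y ≟ₛ ⊤)} → ¬ Spanning P
refuted X Y w {viol} {≢⊤} spanning = toWitnessFalse ≢⊤ (spanning X Y w (toWitness viol))

-- Row V describes the set system whose feasible sets are ∅, E and E − {0, v} for the v with V v.
table₃ : (V : Vec Bool 3) → Spanning (normalForm zero V) → IsomorphicToTarget (normalForm zero V)
table₃ (false ∷ false ∷ false ∷ []) _ = via (Sᵢ-target ℕ.≤-refl) idₚ
table₃ (false ∷ false ∷ true ∷ []) _ = via (𝒯-twist t1 ⊤) (transpose (# 1) (# 2))
table₃ (false ∷ true ∷ false ∷ []) _ = via (𝒯-twist t1 ⊤) idₚ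
table₃ (false ∷ true ∷ true ∷ []) _ = via (𝒯-twist t2 ⊤) idₚ
table₃ (true ∷ false ∷ false ∷ []) _ = via (𝒯-twist t1 ⊥) (transpose (# 0) (# 2))
table₃ (true ∷ false ∷ true ∷ []) _ = via (𝒯-twist t3 ⊤) (transpose (# 1) (# 2))
table₃ (true ∷ true ∷ false ∷ []) _ = via (𝒯-twist t3 ⊤) idₚ
table₃ (true ∷ true ∷ true ∷ []) _ = via (𝒯-twist t4 ⊤) idₚ

table₄ : (V : Vec Bool 4) → Spanning (normalForm zero V) → IsomorphicToTarget (normalForm zero V)
table₄ (false ∷ false ∷ false ∷ false ∷ []) _ = via (Sᵢ-target (ℕ.n≤1+n 3)) idₚ
table₄ (false ∷ false ∷ false ∷ true ∷ []) _ = via (𝒯-twist t5 ⊥) (transpose (# 0) (# 2))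
table₄ (false ∷ false ∷ true ∷ false ∷ []) _ = via (𝒯-twist t5 ⊥) (transpose (# 0) (# 3))
table₄ (false ∷ false ∷ true ∷ true ∷ []) _ = via (𝒯-twist t6 ⊤) (transpose (# 1) (# 3))
table₄ (false ∷ true ∷ false ∷ false ∷ []) _ = via (𝒯-twist t5 ⊤) idₚ
table₄ (false ∷ true ∷ false ∷ true ∷ []) _ = via (𝒯-twist t6 ⊤) (transpose (# 2) (# 3))
table₄ (false ∷ true ∷ true ∷ false ∷ []) _ = via (𝒯-twist t6 ⊤) idₚ
table₄ (false ∷ true ∷ true ∷ true ∷ []) _ = via (𝒯-twist t7 ⊤) idₚ
table₄ (true ∷ false ∷ false ∷ false ∷ []) sp = contradiction sp (refuted ⊥ (∁ ⁅ # 0 ⁆) (# 1))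
table₄ (true ∷ false ∷ false ∷ true ∷ []) sp = contradiction sp (refuted ⊥ (∁ ⁅ # 0 ⁆) (# 3))
table₄ (true ∷ false ∷ true ∷ false ∷ []) sp = contradiction sp (refuted ⊥ (∁ ⁅ # 0 ⁆) (# 2))
table₄ (true ∷ false ∷ true ∷ true ∷ []) sp = contradiction sp (refuted (∁ ⁅ # 0 ⁆) ⊥ (# 1))
table₄ (true ∷ true ∷ false ∷ false ∷ []) sp = contradiction sp (refuted ⊥ (∁ ⁅ # 0 ⁆) (# 1))
table₄ (true ∷ true ∷ false ∷ true ∷ []) sp = contradiction sp (refuted (∁ ⁅ # 0 ⁆) ⊥ (# 2))
table₄ (true ∷ true ∷ true ∷ false ∷ []) sp = contradiction sp (refuted (∁ ⁅ # 0 ⁆) ⊥ (# 3))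
table₄ (true ∷ true ∷ true ∷ true ∷ []) _ = via (𝒯-twist t8 ⊤) idₚ

pivot-spanning⇒isomorphicToTarget : (N : SetSystem (suc n)) → Spanning N → Violation N ⊥ ⊤ zero →
                                    IsomorphicToTarget N
-- For |E| ≤ 2 the set E is itself a pair {0, v}.
pivot-spanning⇒isomorphicToTarget {zero} N spanning viol =
  contradiction (proj₁ (proj₂ viol)) (pair-infeasible spanning viol zero)
pivot-spanning⇒isomorphicToTarget {suc zero} N spanning viol =
  contradiction (proj₁ (proj₂ viol)) (pair-infeasible spanning viol (suc zero))
pivot-spanning⇒isomorphicToTarget {2} N spanning viol =
  isomorphicToTarget-resp N≅nf (table₃ (complementedPairs N zero) (spanning-transport N≅nf spanning))
  where N≅nf = isomorphic-normalForm spanning viol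
pivot-spanning⇒isomorphicToTarget {3} N spanning viol =
  isomorphicToTarget-resp N≅nf (table₄ (complementedPairs N zero) (spanning-transport N≅nf spanning))
  where N≅nf = isomorphic-normalForm spanning viol
pivot-spanning⇒isomorphicToTarget {suc (suc (suc (suc n)))} N spanning viol =
  _ , Sᵢ _ , Sᵢ-target (s≤s (s≤s (s≤s z≤n))) ,
  isomorphic-Sᵢ spanning viol (s≤s (s≤s (s≤s (s≤s (s≤s z≤n)))))

pivot-to-zero : {N : SetSystem (suc n)} {u : Fin (suc n)} → Violation N ⊥ ⊤ u →
                Σ (SetSystem (suc n)) λ N′ → Isomorphic N N′ × Violation N′ ⊥ ⊤ zero
pivot-to-zero {N = N} {u} viol = N′ , N≅N′ ,
  subst₂ (λ X Y → Violation N′ X Y zero) (image-replicate (flip π) false) (image-replicate (flip π) true)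
    (subst (Violation N′ (image (flip π) ⊥) (image (flip π) ⊤)) (inverseˡ π {zero})
           (violation-transport {S = N} {N′} N≅N′ viol))
  where
  π = transpose zero u
  N′ : SetSystem _
  N′ A = N (image π A)
  N≅N′ : Isomorphic N N′
  N≅N′ = isomorphic-sym {S = N′} {N} (isomorphic {S = N′} {N} π λ _ → refl)

spanning⇒isomorphicToTarget : {S : SetSystem n} {X Y : Subset n} {u : Fin n} →
                              Spanning S → Violation S X Y u → IsomorphicToTarget S
spanning⇒isomorphicToTarget {suc n} {S} {X} {Y} {u} spanning viol
  with pivot-to-zero {N = S * X} twisted
  where
  twisted : Violation (S * X) ⊥ ⊤ u
  twisted = subst₂ (λ A B → Violation (S * X) A B u) (△-self X) (trans (△-comm Y X) (spanning X Y u viol))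
                   (violation-twist {S = S} X viol)
... | N′ , N≅N′ , viol′ =
  isomorphicToTarget-twist X (isomorphicToTarget-resp N≅N′ (pivot-spanning⇒isomorphicToTarget N′
    (spanning-transport N≅N′ (spanning-twist X spanning)) viol′))

NonSpanningViolation : SetSystem n → Set
NonSpanningViolation S = ∃ λ X → ∃ λ Y → ∃ λ u → Violation S X Y u × ∃ λ e → e ∉ X △ Y

nonSpanningViolation? : (S : SetSystem n) → Dec (NonSpanningViolation S)
nonSpanningViolation? S = anySubset? λ X → anySubset? λ Y → any? λ u →
  violation? S X Y u ×-dec any? λ e → ¬? (e ∈? X △ Y)

¬nonSpanning⇒spanning : {S : SetSystem n} → ¬ NonSpanningViolation S → Spanning S
¬nonSpanning⇒spanning none X Y u viol = decidable-stable (X △ Y ≟ₛ ⊤) λ X△Y≢⊤ →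
  none (X , Y , u , viol , ≢⊤⇒∃∉ X△Y≢⊤)

violation⇒badMinor : ∀ n (S : SetSystem n) → HasViolation S → HasBadMinor S
violation⇒badMinor zero    S (_ , _ , () , _)
violation⇒badMinor (suc n) S (_ , _ , _ , viol) with nonSpanningViolation? S
... | no  none = suc n , S , here , spanning⇒isomorphicToTarget (¬nonSpanning⇒spanning none) viol
... | yes (_ , _ , _ , viol′ , e , e∉) with violation-shrink viol′ e e∉
...   | S′ , S′≼S , viol″ with violation⇒badMinor n S′ viol″
...     | m , M , M≼S′ , M≅target = m , M , S′≼S M≼S′ , M≅target

theorem5p1 : ∀ (n : ℕ) (S : SetSystem n) → Proper S →
    (IsDeltaMatroid S ⇔ (¬ HasBadMinor S))
theorem5p1 n S proper = mk⇔
  (λ deltaMatroid → noViolation⇒noBadMinor (proj₂ (to (isDeltaMatroid⇔noViolation S) deltaMatroid)))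
  (λ noBadMinor → from (isDeltaMatroid⇔noViolation S) (proper , noBadMinor ∘ violation⇒badMinor n S))
  where open Equivalence
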